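{- Let $A:\mathsf{Type}$, $B:A\to\mathsf{Type}$, $a_0:A$ and $b_0:B(a_0)$, and suppose $a_0$ is isolated in $A$ (so that $a_0=a_0$ is a proposition). Then the map $\big(\sum_{a:A\setminus a_0}B(a)\big)+\big(B(a_0)\setminus b_0\big)\to\big(\sum_{a:A}B(a)\big)\setminus(a_0,b_0)$ sending $\mathrm{inl}((a,h),b)\mapsto((a,b),h')$ and $\mathrm{inr}(b,h)\mapsto((a_0,b),h'')$ (where $h'$ and $h''$ are the induced proofs of inequality) is an equivalence.
   Context: Work in Homotopy Type Theory with a univalent universe. A point $a_0:A$ is isolated if $a_0=b$ is decidable for all $b:A$. $A\setminus a_0:=\sum_{a:A}\neg(a_0=a)$. The inequality proofs: $h'$ is the composite of applying the first projection to a path $(a_0,b_0)=(a,b)$ and then $h:\neg(a_0=a)$; $h''$ refutes $(a_0,b_0)=(a_0,b)$ using that $a_0=a_0$ is a proposition (so the first component of such a path is reflexivity, yielding $b_0=b$, contradicting $h$). -}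

{-# OPTIONS --without-K #-}
module Defs where

-- HoTT-style setting: --without-K, so identity types are not assumed to be
-- propositions.  Function extensionality (which holds in HoTT) is imported
-- as an explicit hypothesis in the statement.

open import Level using (Level; _⊔_)
open import Data.Product using (Σ; Σ-syntax; _,_; proj₁; proj₂)
open import Data.Sum using (_⊎_; inj₁; inj₂)
open import Data.Empty using (⊥; ⊥-elim)
open import Relation.Nullary using (¬_; Dec; yes; no)
open import Relation.Binary.PropositionalEquality
  using (_≡_; refl; sym; trans; cong; subst)

private
  variable
    a b c : Level

isIsolated : {A : Set a} → A → Set a
isIsolated {A = A} a₀ = (x : A) → Dec (a₀ ≡ x)

_∖_ : (A : Set a) → A → Set a
A ∖ a₀ = Σ A (λ x → ¬ (a₀ ≡ x))

isEquiv : {A : Set a} {C : Set c} → (A → C) → Set (a ⊔ c)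
isEquiv {A = A} {C = C} f =
  (Σ (C → A) λ g → (x : A) → g (f x) ≡ x) ×' (Σ (C → A) λ h → (y : C) → f (h y) ≡ y)
  where
    _×'_ : ∀ {p q} → Set p → Set q → Set (p ⊔ q)
    P ×' Q = Σ P (λ _ → Q)

-- Local Hedberg: if a₀ is isolated then every path a₀ = x is unique;
-- in particular a₀ = a₀ is a proposition.
module _ {A : Set a} {a₀ : A} (d : isIsolated a₀) where
  private
    norm : (x : A) → a₀ ≡ x → a₀ ≡ x
    norm x p with d x
    ... | yes q = q
    ... | no n = ⊥-elim (n p)

    norm-const : (x : A) (p q : a₀ ≡ x) → norm x p ≡ norm x q
    norm-const x p q with d x
    ... | yes _ = refl
    ... | no n = ⊥-elim (n p)

    canon : (x : A) (p : a₀ ≡ x) → trans (sym (norm a₀ refl)) (norm x p) ≡ p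
    canon x refl = lemma (norm a₀ refl)
      where
        lemma : ∀ {y} (r : a₀ ≡ y) → trans (sym r) r ≡ refl
        lemma refl = refl

  isolated-paths-unique : (x : A) (p q : a₀ ≡ x) → p ≡ q
  isolated-paths-unique x p q =
    trans (sym (canon x p))
      (trans (cong (trans (sym (norm a₀ refl))) (norm-const x p q)) (canon x q))

Σ-path-snd : {A : Set a} {B : A → Set b} {x y : A} {u : B x} {v : B y}
  (e : (x , u) ≡ (y , v)) → subst B (cong proj₁ e) u ≡ v
Σ-path-snd refl = refl

module _ {A : Set a} {B : A → Set b} {a₀ : A} {b₀ : B a₀} where

  ineq-inl : {x : A} {y : B x} → ¬ (a₀ ≡ x) →
             ¬ (_≡_ {A = Σ A B} (a₀ , b₀) (x , y))
  ineq-inl h e = h (cong proj₁ e)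

  -- h'' : from h : ¬ (b₀ = b), refute (a₀ , b₀) = (a₀ , b) using that
  -- a₀ = a₀ is a proposition (first component of the path is refl)
  ineq-inr : isIsolated a₀ → {y : B a₀} → ¬ (b₀ ≡ y) →
             ¬ (_≡_ {A = Σ A B} (a₀ , b₀) (a₀ , y))
  ineq-inr d h e =
    h (subst (λ p → subst B p b₀ ≡ _)
             (isolated-paths-unique d a₀ (cong proj₁ e) refl)
             (Σ-path-snd e))

  prop2p21-map : isIsolated a₀ →
    (Σ (A ∖ a₀) (λ p → B (proj₁ p))) ⊎ (B a₀ ∖ b₀) →
    (Σ A B) ∖ (a₀ , b₀)
  prop2p21-map d (inj₁ ((x , h) , y)) = (x , y) , ineq-inl h
  prop2p21-map d (inj₂ (y , h)) = (a₀ , y) , ineq-inr d h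

{-# OPTIONS --without-K #-}
-- The inverse decides whether the first component equals a₀.  If not, the
-- point lies in the left summand; if so, the path can be taken to be refl,
-- and the point is (a₀ , b) with b ≠ b₀.  The round trips agree because
-- inequality proofs are propositions (funext), and because the only path
-- a₀ = a₀ is refl when a₀ is isolated.
module Submission where

open import Defs
open import Level using (Level; 0ℓ; _⊔_)
open import Axiom.Extensionality.Propositional using (Extensionality)
open import Data.Product using (Σ; _,_; proj₁)
open import Data.Sum using (_⊎_; inj₁; inj₂)
open import Data.Empty using (⊥-elim)
open import Relation.Nullary using (¬_; Dec; yes; no)
open import Relation.Nullary.Irrelevant using (Irrelevant)
open import Relation.Binary.PropositionalEquality using (_≡_; refl; cong)

private
  variable
    ℓ ℓ′ : Level
    X Y : Set ℓ

¬-irrelevant : {X : Set ℓ} → Extensionality ℓ 0ℓ → Irrelevant (¬ X)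
¬-irrelevant funext u v = funext (λ x → ⊥-elim (u x))

inverse⇒isEquiv : {f : X → Y} (g : Y → X) →
  (∀ x → g (f x) ≡ x) → (∀ y → f (g y) ≡ y) → isEquiv f
inverse⇒isEquiv g g∘f f∘g = (g , g∘f) , (g , f∘g)

module _ (funext : ∀ {ℓ ℓ′} → Extensionality ℓ ℓ′)
  {A : Set ℓ} {B : A → Set ℓ′} {a₀ : A} {b₀ : B a₀} (d : isIsolated a₀) where

  private
    Source Target : Set (ℓ ⊔ ℓ′)
    Source = (Σ (A ∖ a₀) (λ p → B (proj₁ p))) ⊎ (B a₀ ∖ b₀)
    Target = (Σ A B) ∖ (a₀ , b₀)

    map : Source → Target
    map = prop2p21-map {B = B} {b₀ = b₀} d

  prop2p21-inverse-by-cases : (x : A) (y : B x) →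
    ¬ (_≡_ {A = Σ A B} (a₀ , b₀) (x , y)) → Dec (a₀ ≡ x) → Source
  prop2p21-inverse-by-cases x y _ (no a₀≢x) = inj₁ ((x , a₀≢x) , y)
  prop2p21-inverse-by-cases _ y h (yes refl) = inj₂ (y , λ b₀≡y → h (cong (a₀ ,_) b₀≡y))

  prop2p21-inverse : Target → Source
  prop2p21-inverse ((x , y) , h) = prop2p21-inverse-by-cases x y h (d x)

  prop2p21-inverseˡ : ∀ u → prop2p21-inverse (map u) ≡ u
  prop2p21-inverseˡ (inj₁ ((x , h) , y)) with d x
  ... | no a₀≢x = cong (λ k → inj₁ ((x , k) , y)) (¬-irrelevant funext a₀≢x h)
  ... | yes a₀≡x = ⊥-elim (h a₀≡x)
  prop2p21-inverseˡ (inj₂ (y , h)) = at-a₀ (d a₀)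
    where
      -- d a₀ also occurs inside ineq-inr d h, so it is generalised by hand.
      at-a₀ : (D : Dec (a₀ ≡ a₀)) →
        prop2p21-inverse-by-cases a₀ y (ineq-inr d h) D ≡ inj₂ (y , h)
      at-a₀ (no a₀≢a₀) = ⊥-elim (a₀≢a₀ refl)
      at-a₀ (yes p) rewrite isolated-paths-unique d a₀ p refl =
        cong (λ k → inj₂ (y , k)) (¬-irrelevant funext _ h)

  prop2p21-inverseʳ : ∀ v → map (prop2p21-inverse v) ≡ v
  prop2p21-inverseʳ ((x , y) , h) with d x
  ... | no _ = cong ((x , y) ,_) (¬-irrelevant funext _ h)
  ... | yes refl = cong ((a₀ , y) ,_) (¬-irrelevant funext _ h)

proposition2p21 : (funext : ∀ {ℓ ℓ'} → Extensionality ℓ ℓ') →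
    {ℓa ℓb : Level} (A : Set ℓa) (B : A → Set ℓb) (a₀ : A) (b₀ : B a₀)
    (d : isIsolated a₀) → isEquiv (prop2p21-map {B = B} {b₀ = b₀} d)
proposition2p21 funext A B a₀ b₀ d =
  inverse⇒isEquiv (prop2p21-inverse funext d)
    (prop2p21-inverseˡ funext d) (prop2p21-inverseʳ funext d)
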